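{- Let $M$ be a convex polygon in the plane with at least $4$ vertices, and suppose its vertex set is partitioned into three subsets $A,B,C$. Suppose the vertices of one of these subsets are separated by the vertices of the others in the circular order, i.e. (say for $A$) there are vertices $a_1,a_2\in A$ such that each of the two arcs of the circular order of vertices strictly between $a_1$ and $a_2$ contains a vertex from $B\cup C$. Then every point of $M$ belongs to $\mathrm{ch}(A\cup B)\cup\mathrm{ch}(A\cup C)\cup\mathrm{ch}(B\cup C)$.
   Context: $\mathrm{ch}$ denotes the convex hull in $\mathbb{R}^2$; the polygon $M$ is identified with the closed convex region it bounds. -}

module Defs where

open import Level using (0ℓ)
open import Algebra.Bundles using (CommutativeRing)
open import Data.Nat using (ℕ; zero; suc)
open import Data.Fin using (Fin; toℕ) renaming (zero to fz; suc to fs)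
open import Data.Product using (Σ; ∃; _×_; _,_)
open import Data.Sum using (_⊎_)
open import Relation.Binary.PropositionalEquality using (_≡_)
open import Relation.Nullary using (¬_)
import Data.Nat as N

-- The real numbers, axiomatised as a Dedekind-complete ordered field
-- (unique up to isomorphism).  Any instance of this record is ℝ.
record RealField : Set₁ where
  field
    ℝring : CommutativeRing 0ℓ 0ℓ
  open CommutativeRing ℝring public
  field
    _<_       : Carrier → Carrier → Set
    nontrivial : ¬ (0# ≈ 1#)
    inverse   : ∀ x → ¬ (x ≈ 0#) → Σ Carrier (λ y → x * y ≈ 1#)
    <-resp    : ∀ {a b c d} → a ≈ b → c ≈ d → a < c → b < d
    <-irrefl  : ∀ {a} → ¬ (a < a)
    <-trans   : ∀ {a b c} → a < b → b < c → a < c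
    <-tri     : ∀ a b → a < b ⊎ (a ≈ b ⊎ b < a)
    <-+       : ∀ {a b} c → a < b → (a + c) < (b + c)
    <-*       : ∀ {a b} → 0# < a → 0# < b → 0# < (a * b)
    complete  : (P : Carrier → Set) → Σ Carrier P →
                Σ Carrier (λ u → ∀ x → P x → (x < u ⊎ x ≈ u)) →
                Σ Carrier (λ s → (∀ x → P x → (x < s ⊎ x ≈ s)) ×
                  (∀ u → (∀ x → P x → (x < u ⊎ x ≈ u)) → (s < u ⊎ s ≈ u)))

module Geometry (ℝ : RealField) where
  open RealField ℝ

  _≤ᵣ_ : Carrier → Carrier → Set
  a ≤ᵣ b = a < b ⊎ a ≈ b

  record Point : Set where
    constructor ⟨_,_⟩
    field
      x : Carrier
      y : Carrier
  open Point public

  Σᶠ : (n : ℕ) → (Fin n → Carrier) → Carrier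
  Σᶠ zero    f = 0#
  Σᶠ (suc n) f = f fz + Σᶠ n (λ i → f (fs i))

  orient : Point → Point → Point → Carrier
  orient p q r = ((x q - x p) * (y r - y p)) - ((y q - y p) * (x r - x p))

  -- M is a convex polygon whose vertices, listed in circular (boundary)
  -- order, are v 0, ..., v (n-1): every triple of vertices taken in that
  -- order has the same (nonzero) orientation — all counterclockwise or all
  -- clockwise.  (Strict, so vertices are genuine corners and distinct.)
  ConvexPolygon : (n : ℕ) → (Fin n → Point) → Set
  ConvexPolygon n v =
      (∀ (i j k : Fin n) → toℕ i N.< toℕ j → toℕ j N.< toℕ k →
          0# < orient (v i) (v j) (v k))
    ⊎ (∀ (i j k : Fin n) → toℕ i N.< toℕ j → toℕ j N.< toℕ k →
          orient (v i) (v j) (v k) < 0#)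

  InHull : (n : ℕ) → (Fin n → Point) → (Fin n → Set) → Point → Set
  InHull n v S p =
    Σ (Fin n → Carrier) λ w →
        (∀ k → 0# ≤ᵣ w k)
      × (∀ k → ¬ S k → w k ≈ 0#)
      × (Σᶠ n w ≈ 1#)
      × (Σᶠ n (λ k → w k * x (v k)) ≈ x p)
      × (Σᶠ n (λ k → w k * y (v k)) ≈ y p)

data Part : Set where
  A B C : Part

-- the vertices labelled X are separated in the circular order by vertices
-- of the other parts: there are a₁ (index i) and a₂ (index j), i < j, both in X,
-- such that both open arcs between them contain a vertex not in X.
Separated : (n : ℕ) → (Fin n → Part) → Part → Set
Separated n lab X =
  Σ (Fin n) λ i → Σ (Fin n) λ j →
      toℕ i N.< toℕ j × lab i ≡ X × lab j ≡ X
    × Σ (Fin n) (λ k → toℕ i N.< toℕ k × toℕ k N.< toℕ j × ¬ (lab k ≡ X))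
    × Σ (Fin n) (λ k → (toℕ k N.< toℕ i ⊎ toℕ j N.< toℕ k) × ¬ (lab k ≡ X))

module Submission where

-- It suffices to find a triangle of vertices containing p whose labels take
-- at most two values.  After a reflection the polygon is counterclockwise.
-- The chord between the separated X-vertices a₁, a₂ cuts M in two.  Reading
-- the vertices cyclically from one end s of the chord to the other end e
-- along p's side gives a convex chain s = q 0 , … , q m = e with m ≥ 2,
-- followed by a vertex y ∉ X of the other side.  The fan from s
-- triangulates the polygon q 0 … q m, so p lies in a fan triangle s u w.
-- If that triangle is rainbow, y has the label of u or of w; splitting the
-- convex quadrilateral s u w y (resp. s u w e, then u w e y) along a
-- diagonal gives a triangle containing p with a repeated label.

open import Defs
open import Level using (0ℓ)
open import Algebra.Bundles using (RawRing)
open import Data.Nat as ℕ using (ℕ; zero; suc; z≤n; s≤s; NonZero) renaming (_≤_ to _≤ℕ_; _<_ to _<ℕ_)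
import Data.Nat.Properties as ℕP
open import Data.Fin using (Fin; toℕ) renaming (zero to fz; suc to fs)
import Data.Fin.Properties as FinP
open import Data.Product using (Σ; _×_; _,_; proj₂)
open import Data.Sum as Sum using (_⊎_; inj₁; inj₂)
open import Data.Unit using (⊤; tt)
open import Data.Empty using (⊥; ⊥-elim)
open import Data.Maybe using (Maybe; just; nothing)
open import Relation.Nullary using (¬_; Dec; yes; no)
open import Relation.Binary.PropositionalEquality as P using (_≡_)
open import Relation.Binary.Definitions using (tri<; tri≈; tri>)

-- The library solver needs a
-- coefficient ring with decidable equality mapping into ℝ; we use
-- integers presented as differences (a , b) ↦ a·1 − b·1 of naturals.
IntegerDifferences : RawRing 0ℓ 0ℓ
IntegerDifferences = record
  { Carrier = ℕ × ℕ
  ; _≈_ = _≡_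
  ; _+_ = λ (a , b) (c , d) → (a ℕ.+ c , b ℕ.+ d)
  ; _*_ = λ (a , b) (c , d) → (a ℕ.* c ℕ.+ b ℕ.* d , a ℕ.* d ℕ.+ b ℕ.* c)
  ; -_ = λ (a , b) → (b , a)
  ; 0# = (0 , 0)
  ; 1# = (1 , 0)
  }

module RingSolver (ℝ : RealField) where
  open RealField ℝ
  open import Algebra.Properties.Semiring.Mult semiring
    using (×-homo-+; ×1-homo-*; ×-homo-0; ×-homo-1) renaming (_×_ to _·_)
  open import Algebra.Properties.Ring ring
    using (-‿distribˡ-*; -‿distribʳ-*; -‿involutive; -‿+-comm; -0#≈0#; x∙y⁻¹≈ε⇒x≈y; x≈y⇒x∙y⁻¹≈ε)
  open import Algebra.Properties.CommutativeSemigroup +-commutativeSemigroup using (interchange)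
  open import Algebra.Solver.Ring.AlmostCommutativeRing
    using (_-Raw-AlmostCommutative⟶_; fromCommutativeRing)
  open import Relation.Binary.Reasoning.Setoid setoid

  embed : ℕ × ℕ → Carrier
  embed (a , b) = a · 1# - b · 1#

  embed-+ : ∀ m n → embed (RawRing._+_ IntegerDifferences m n) ≈ embed m + embed n
  embed-+ (a , b) (c , d) = begin
    (a ℕ.+ c) · 1# - (b ℕ.+ d) · 1#    ≈⟨ +-cong (×-homo-+ 1# a c) (-‿cong (×-homo-+ 1# b d)) ⟩
    (a′ + c′) + - (b′ + d′)             ≈⟨ +-congˡ (sym (-‿+-comm b′ d′)) ⟩
    (a′ + c′) + (- b′ + - d′)           ≈⟨ interchange a′ c′ (- b′) (- d′) ⟩
    (a′ - b′) + (c′ - d′)               ∎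
    where
    a′ b′ c′ d′ : Carrier
    a′ = a · 1#
    b′ = b · 1#
    c′ = c · 1#
    d′ = d · 1#

  embed-* : ∀ m n → embed (RawRing._*_ IntegerDifferences m n) ≈ embed m * embed n
  embed-* (a , b) (c , d) = begin
    (a ℕ.* c ℕ.+ b ℕ.* d) · 1# - (a ℕ.* d ℕ.+ b ℕ.* c) · 1#
      ≈⟨ +-cong (embedSum a c b d) (-‿cong (embedSum a d b c)) ⟩
    (a′ * c′ + b′ * d′) + - (a′ * d′ + b′ * c′)
      ≈⟨ +-congˡ (sym (-‿+-comm _ _)) ⟩
    (a′ * c′ + b′ * d′) + (- (a′ * d′) + - (b′ * c′))
      ≈⟨ interchange _ _ _ _ ⟩
    (a′ * c′ + - (a′ * d′)) + (b′ * d′ + - (b′ * c′))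
      ≈⟨ +-congˡ (+-comm _ _) ⟩
    (a′ * c′ + - (a′ * d′)) + (- (b′ * c′) + b′ * d′)
      ≈⟨ +-cong (+-congˡ (-‿distribʳ-* a′ d′)) (+-cong (-‿distribˡ-* b′ c′) negNeg) ⟩
    (a′ * c′ + a′ * - d′) + (- b′ * c′ + - b′ * - d′)
      ≈⟨ sym (+-cong (distribˡ a′ c′ (- d′)) (distribˡ (- b′) c′ (- d′))) ⟩
    a′ * (c′ - d′) + - b′ * (c′ - d′)
      ≈⟨ sym (distribʳ (c′ - d′) a′ (- b′)) ⟩
    (a′ - b′) * (c′ - d′) ∎
    where
    a′ b′ c′ d′ : Carrier
    a′ = a · 1#
    b′ = b · 1#
    c′ = c · 1#
    d′ = d · 1#
    embedSum : ∀ p q r s → (p ℕ.* q ℕ.+ r ℕ.* s) · 1# ≈ (p · 1#) * (q · 1#) + (r · 1#) * (s · 1#)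
    embedSum p q r s = trans (×-homo-+ 1# (p ℕ.* q) (r ℕ.* s)) (+-cong (×1-homo-* p q) (×1-homo-* r s))
    negNeg : b′ * d′ ≈ - b′ * - d′
    negNeg = begin
      b′ * d′         ≈⟨ sym (-‿involutive _) ⟩
      - - (b′ * d′)   ≈⟨ -‿cong (-‿distribʳ-* b′ d′) ⟩
      - (b′ * - d′)   ≈⟨ -‿distribˡ-* b′ (- d′) ⟩
      - b′ * - d′     ∎

  embed-neg : ∀ m → embed (RawRing.-_ IntegerDifferences m) ≈ - embed m
  embed-neg (a , b) = begin
    b · 1# - a · 1#         ≈⟨ +-comm _ _ ⟩
    - (a · 1#) + b · 1#     ≈⟨ +-congˡ (sym (-‿involutive _)) ⟩
    - (a · 1#) + - - (b · 1#) ≈⟨ -‿+-comm _ _ ⟩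
    - (a · 1# - b · 1#)     ∎

  embed-0 : embed (0 , 0) ≈ 0#
  embed-0 = -‿inverseʳ _

  embed-1 : embed (1 , 0) ≈ 1#
  embed-1 = trans (+-cong (×-homo-1 1#) (trans (-‿cong (×-homo-0 1#)) -0#≈0#)) (+-identityʳ 1#)

  embedding : IntegerDifferences -Raw-AlmostCommutative⟶ fromCommutativeRing ℝring
  embedding = record
    { ⟦_⟧ = embed ; +-homo = embed-+ ; *-homo = embed-* ; -‿homo = embed-neg
    ; 0-homo = embed-0 ; 1-homo = embed-1 }

  embed-≟ : ∀ m n → Maybe (embed m ≈ embed n)
  embed-≟ (a , b) (c , d) with a ℕ.+ d ℕP.≟ c ℕ.+ b
  ... | no _ = nothing
  ... | yes a+d≡c+b = just (x∙y⁻¹≈ε⇒x≈y _ _ (begin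
    embed (a , b) - embed (c , d)    ≈⟨ +-congˡ (sym (embed-neg (c , d))) ⟩
    embed (a , b) + embed (d , c)    ≈⟨ sym (embed-+ (a , b) (d , c)) ⟩
    embed (a ℕ.+ d , b ℕ.+ c)        ≈⟨ x≈y⇒x∙y⁻¹≈ε (reflexive (P.cong (_· 1#) a+d≡b+c)) ⟩
    0# ∎))
    where
    a+d≡b+c : a ℕ.+ d ≡ b ℕ.+ c
    a+d≡b+c = P.trans a+d≡c+b (ℕP.+-comm c b)

  open import Algebra.Solver.Ring IntegerDifferences (fromCommutativeRing ℝring) embedding embed-≟ public
    using (solve; _:=_; _:+_; _:*_; _:-_; :-_; con; Polynomial)

module OrderedField (ℝ : RealField) where
  open RealField ℝ
  open Geometry ℝ using (_≤ᵣ_)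
  open import Algebra.Properties.Ring ring using (-‿distribˡ-*; -‿distribʳ-*; -‿involutive)

  ≤-resp : ∀ {a b c d} → a ≈ b → c ≈ d → a ≤ᵣ c → b ≤ᵣ d
  ≤-resp a≈b c≈d (inj₁ a<c) = inj₁ (<-resp a≈b c≈d a<c)
  ≤-resp a≈b c≈d (inj₂ a≈c) = inj₂ (trans (sym a≈b) (trans a≈c c≈d))

  neg-pos : ∀ {a} → a < 0# → 0# < (- a)
  neg-pos {a} a<0 = <-resp (-‿inverseʳ a) (+-identityˡ (- a)) (<-+ (- a) a<0)

  pos-neg : ∀ {a} → 0# < a → (- a) < 0#
  pos-neg {a} 0<a = <-resp (+-identityˡ (- a)) (-‿inverseʳ a) (<-+ (- a) 0<a)

  sign : ∀ a → 0# ≤ᵣ a ⊎ 0# ≤ᵣ (- a)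
  sign a with <-tri 0# a
  ... | inj₁ 0<a       = inj₁ (inj₁ 0<a)
  ... | inj₂ (inj₁ 0≈a) = inj₁ (inj₂ 0≈a)
  ... | inj₂ (inj₂ a<0) = inj₂ (inj₁ (neg-pos a<0))

  -- 1 is positive: otherwise 1 < 0 and 0 < (−1)(−1) = 1
  0<1 : 0# < 1#
  0<1 with <-tri 0# 1#
  ... | inj₁ 0<1       = 0<1
  ... | inj₂ (inj₁ 0≈1) = ⊥-elim (nontrivial 0≈1)
  ... | inj₂ (inj₂ 1<0) = ⊥-elim (<-irrefl (<-trans 1<0 (<-resp refl negSquare (<-* (neg-pos 1<0) (neg-pos 1<0)))))
    where
    negSquare : - 1# * - 1# ≈ 1#
    negSquare = trans (sym (-‿distribˡ-* 1# (- 1#))) (trans (-‿cong (*-identityˡ (- 1#))) (-‿involutive 1#))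

  +-nonneg : ∀ {a b} → 0# ≤ᵣ a → 0# ≤ᵣ b → 0# ≤ᵣ (a + b)
  +-nonneg {a} {b} (inj₁ 0<a) (inj₁ 0<b) = inj₁ (<-trans 0<a (<-resp (+-identityˡ a) (+-comm b a) (<-+ a 0<b)))
  +-nonneg {a} {b} (inj₁ 0<a) (inj₂ 0≈b) = inj₁ (<-resp refl (trans (sym (+-identityʳ a)) (+-congˡ 0≈b)) 0<a)
  +-nonneg {a} {b} (inj₂ 0≈a) 0≤b = ≤-resp refl (trans (sym (+-identityˡ b)) (+-congʳ 0≈a)) 0≤b

  *-nonneg : ∀ {a b} → 0# ≤ᵣ a → 0# ≤ᵣ b → 0# ≤ᵣ (a * b)
  *-nonneg (inj₁ 0<a) (inj₁ 0<b) = inj₁ (<-* 0<a 0<b)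
  *-nonneg {a} _ (inj₂ 0≈b) = inj₂ (sym (trans (*-congˡ (sym 0≈b)) (zeroʳ a)))
  *-nonneg {a} {b} (inj₂ 0≈a) _ = inj₂ (sym (trans (*-congʳ (sym 0≈a)) (zeroˡ b)))

  inverse-pos : ∀ {d e} → 0# < d → d * e ≈ 1# → 0# < e
  inverse-pos {d} {e} 0<d de≈1 with <-tri 0# e
  ... | inj₁ 0<e       = 0<e
  ... | inj₂ (inj₁ 0≈e) = ⊥-elim (nontrivial (trans (sym (zeroʳ d)) (trans (*-congˡ 0≈e) de≈1)))
  ... | inj₂ (inj₂ e<0) = ⊥-elim (<-irrefl (<-trans 0<1 (<-resp negProduct refl (pos-neg (<-* 0<d (neg-pos e<0))))))
    where
    negProduct : - (d * - e) ≈ 1#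
    negProduct = trans (-‿cong (sym (-‿distribʳ-* d e))) (trans (-‿involutive _) de≈1)

module FiniteSums (ℝ : RealField) where
  open RealField ℝ
  open Geometry ℝ
  open OrderedField ℝ
  open import Algebra.Properties.CommutativeMonoid.Sum +-commutativeMonoid
    using (sum; sum-cong-≋; ∑-comm; sum-replicate-zero)
  open import Relation.Binary.Reasoning.Setoid setoid

  Σᶠ≡sum : ∀ n (f : Fin n → Carrier) → Σᶠ n f ≡ sum f
  Σᶠ≡sum zero    f = P.refl
  Σᶠ≡sum (suc n) f = P.cong (f fz +_) (Σᶠ≡sum n (λ k → f (fs k)))

  Σ-cong : ∀ n {f g : Fin n → Carrier} → (∀ k → f k ≈ g k) → Σᶠ n f ≈ Σᶠ n g
  Σ-cong n {f} {g} f≈g = begin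
    Σᶠ n f ≡⟨ Σᶠ≡sum n f ⟩
    sum f  ≈⟨ sum-cong-≋ f≈g ⟩
    sum g  ≡⟨ Σᶠ≡sum n g ⟨
    Σᶠ n g ∎

  Σ-zero : ∀ n → Σᶠ n (λ _ → 0#) ≈ 0#
  Σ-zero n = trans (reflexive (Σᶠ≡sum n _)) (sum-replicate-zero n)

  Σ-swap : ∀ m n (f : Fin m → Fin n → Carrier) →
           Σᶠ m (λ i → Σᶠ n (f i)) ≈ Σᶠ n (λ j → Σᶠ m (λ i → f i j))
  Σ-swap m n f = begin
    Σᶠ m (λ i → Σᶠ n (f i))             ≈⟨ Σ-cong m (λ i → reflexive (Σᶠ≡sum n (f i))) ⟩
    Σᶠ m (λ i → sum (f i))              ≡⟨ Σᶠ≡sum m _ ⟩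
    sum (λ i → sum (f i))               ≈⟨ ∑-comm f ⟩
    sum (λ j → sum (λ i → f i j))       ≡⟨ Σᶠ≡sum n _ ⟨
    Σᶠ n (λ j → sum (λ i → f i j))      ≈⟨ Σ-cong n (λ j → reflexive (P.sym (Σᶠ≡sum m _))) ⟩
    Σᶠ n (λ j → Σᶠ m (λ i → f i j))     ∎

  Σ-scaleˡ : ∀ n c (f : Fin n → Carrier) → c * Σᶠ n f ≈ Σᶠ n (λ k → c * f k)
  Σ-scaleˡ zero    c f = zeroʳ c
  Σ-scaleˡ (suc n) c f = trans (distribˡ c _ _) (+-congˡ (Σ-scaleˡ n c (λ k → f (fs k))))

  Σ-scaleʳ : ∀ n c (f : Fin n → Carrier) → Σᶠ n f * c ≈ Σᶠ n (λ k → f k * c)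
  Σ-scaleʳ n c f = trans (*-comm _ c) (trans (Σ-scaleˡ n c f) (Σ-cong n (λ k → *-comm c (f k))))

  Σ-nonneg : ∀ n (f : Fin n → Carrier) → (∀ k → 0# ≤ᵣ f k) → 0# ≤ᵣ Σᶠ n f
  Σ-nonneg zero    f f≥0 = inj₂ refl
  Σ-nonneg (suc n) f f≥0 = +-nonneg (f≥0 fz) (Σ-nonneg n (λ k → f (fs k)) (λ k → f≥0 (fs k)))

  δ : ∀ {n} → Fin n → Fin n → Carrier
  δ fz     fz     = 1#
  δ fz     (fs _) = 0#
  δ (fs _) fz     = 0#
  δ (fs i) (fs j) = δ i j

  δ-nonneg : ∀ {n} (i j : Fin n) → 0# ≤ᵣ δ i j
  δ-nonneg fz     fz     = inj₁ 0<1
  δ-nonneg fz     (fs _) = inj₂ refl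
  δ-nonneg (fs _) fz     = inj₂ refl
  δ-nonneg (fs i) (fs j) = δ-nonneg i j

  δ-≢ : ∀ {n} (i j : Fin n) → ¬ i ≡ j → δ i j ≈ 0#
  δ-≢ fz     fz     i≢j = ⊥-elim (i≢j P.refl)
  δ-≢ fz     (fs _) _   = refl
  δ-≢ (fs _) fz     _   = refl
  δ-≢ (fs i) (fs j) i≢j = δ-≢ i j (λ i≡j → i≢j (P.cong fs i≡j))

  δ-sum : ∀ n (i : Fin n) (g : Fin n → Carrier) → Σᶠ n (λ j → δ i j * g j) ≈ g i
  δ-sum (suc n) fz     g = begin
    1# * g fz + Σᶠ n (λ j → 0# * g (fs j)) ≈⟨ +-cong (*-identityˡ _) (Σ-cong n (λ j → zeroˡ _)) ⟩
    g fz + Σᶠ n (λ _ → 0#)                 ≈⟨ +-congˡ (Σ-zero n) ⟩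
    g fz + 0#                              ≈⟨ +-identityʳ _ ⟩
    g fz                                   ∎
  δ-sum (suc n) (fs i) g = trans (+-cong (zeroˡ _) (δ-sum n i (λ j → g (fs j)))) (+-identityˡ _)

  -- The weight of
  -- v j is the total weight of the points sent to it.
  hull-map : ∀ {m n} {u : Fin m → Point} {v : Fin n → Point} {S : Fin n → Set} {p}
    (f : Fin m → Fin n) → (∀ k → u k ≡ v (f k)) → (∀ k → S (f k)) →
    InHull m u (λ _ → ⊤) p → InHull n v S p
  hull-map {m} {n} {u} {v} {S} {p} f u≡vf inS (w , w≥0 , _ , Σw≈1 , Σwx≈x , Σwy≈y) =
    pushed ,
    (λ j → Σ-nonneg m _ (λ k → *-nonneg (w≥0 k) (δ-nonneg (f k) j))) ,
    pushed-outside ,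
    (begin
      Σᶠ n pushed                      ≈⟨ Σ-cong n (λ j → sym (*-identityʳ _)) ⟩
      Σᶠ n (λ j → pushed j * 1#)       ≈⟨ pushforward (λ _ → 1#) ⟩
      Σᶠ m (λ k → w k * 1#)            ≈⟨ Σ-cong m (λ k → *-identityʳ _) ⟩
      Σᶠ m w                           ≈⟨ Σw≈1 ⟩
      1#                               ∎) ,
    coordinate x Σwx≈x ,
    coordinate y Σwy≈y
    where
    pushed : Fin n → Carrier
    pushed j = Σᶠ m (λ k → w k * δ (f k) j)

    pushed-outside : ∀ j → ¬ S j → pushed j ≈ 0#
    pushed-outside j ¬Sj = trans (Σ-cong m term≈0) (Σ-zero m)
      where
      term≈0 : ∀ k → w k * δ (f k) j ≈ 0#
      term≈0 k = trans (*-congˡ (δ-≢ (f k) j (λ fk≡j → ¬Sj (P.subst S fk≡j (inS k))))) (zeroʳ (w k))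

    pushforward : ∀ g → Σᶠ n (λ j → pushed j * g j) ≈ Σᶠ m (λ k → w k * g (f k))
    pushforward g = begin
      Σᶠ n (λ j → pushed j * g j)                        ≈⟨ Σ-cong n (λ j → Σ-scaleʳ m (g j) _) ⟩
      Σᶠ n (λ j → Σᶠ m (λ k → (w k * δ (f k) j) * g j))  ≈⟨ Σ-swap n m _ ⟩
      Σᶠ m (λ k → Σᶠ n (λ j → (w k * δ (f k) j) * g j))  ≈⟨ Σ-cong m (λ k → Σ-cong n (λ j → *-assoc (w k) _ _)) ⟩
      Σᶠ m (λ k → Σᶠ n (λ j → w k * (δ (f k) j * g j)))  ≈⟨ Σ-cong m (λ k → sym (Σ-scaleˡ n (w k) _)) ⟩
      Σᶠ m (λ k → w k * Σᶠ n (λ j → δ (f k) j * g j))    ≈⟨ Σ-cong m (λ k → *-congˡ (δ-sum n (f k) g)) ⟩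
      Σᶠ m (λ k → w k * g (f k))                         ∎

    coordinate : (c : Point → Carrier) → Σᶠ m (λ k → w k * c (u k)) ≈ c p →
      Σᶠ n (λ j → pushed j * c (v j)) ≈ c p
    coordinate c Σwc≈c = begin
      Σᶠ n (λ j → pushed j * c (v j))   ≈⟨ pushforward (λ j → c (v j)) ⟩
      Σᶠ m (λ k → w k * c (v (f k)))    ≈⟨ Σ-cong m (λ k → *-congˡ (reflexive (P.cong c (P.sym (u≡vf k))))) ⟩
      Σᶠ m (λ k → w k * c (u k))        ≈⟨ Σwc≈c ⟩
      c p                               ∎

module PlaneGeometry (ℝ : RealField) where
  open RealField ℝ
  open Geometry ℝ
  open RingSolver ℝ
  open OrderedField ℝ
  open FiniteSums ℝ
  open import Relation.Binary.Reasoning.Setoid setoid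

  orientₚ : ∀ {n} (a b c d e f : Polynomial n) → Polynomial n
  orientₚ a b c d e f = ((c :- a) :* (f :- b)) :- ((d :- b) :* (e :- a))

  orient-cyclic : ∀ q r s → orient q r s ≈ orient r s q
  orient-cyclic q r s = solve 6 (λ a b c d e f → orientₚ a b c d e f := orientₚ c d e f a b) refl
    (x q) (y q) (x r) (y r) (x s) (y s)

  orient-swap : ∀ q r s → - orient q r s ≈ orient r q s
  orient-swap q r s = solve 6 (λ a b c d e f → :- orientₚ a b c d e f := orientₚ c d a b e f) refl
    (x q) (y q) (x r) (y r) (x s) (y s)

  orient-tail : ∀ e f → orient e f e ≈ 0#
  orient-tail e f = trans (solve 4 (λ a b c d → orientₚ a b c d a b := con (0 , 0)) refl
    (x e) (y e) (x f) (y f)) embed-0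

  orient-head : ∀ e f → orient e f f ≈ 0#
  orient-head e f = trans (solve 4 (λ a b c d → orientₚ a b c d c d := con (0 , 0)) refl
    (x e) (y e) (x f) (y f)) embed-0

  -- Cramer's rule: the three sub-triangles at p add up to the triangle q r s,
  -- also when weighted by the coordinates of the opposite vertex.
  orient-sum : ∀ q r s p → orient r s p + orient s q p + orient q r p ≈ orient q r s
  orient-sum q r s p = solve 8 (λ a b c d e f g h →
      orientₚ c d e f g h :+ orientₚ e f a b g h :+ orientₚ a b c d g h := orientₚ a b c d e f) refl
    (x q) (y q) (x r) (y r) (x s) (y s) (x p) (y p)

  orient-sum-x : ∀ q r s p →
    orient r s p * x q + orient s q p * x r + orient q r p * x s ≈ orient q r s * x p
  orient-sum-x q r s p = solve 8 (λ a b c d e f g h →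
      orientₚ c d e f g h :* a :+ orientₚ e f a b g h :* c :+ orientₚ a b c d g h :* e
        := orientₚ a b c d e f :* g) refl
    (x q) (y q) (x r) (y r) (x s) (y s) (x p) (y p)

  orient-sum-y : ∀ q r s p →
    orient r s p * y q + orient s q p * y r + orient q r p * y s ≈ orient q r s * y p
  orient-sum-y q r s p = solve 8 (λ a b c d e f g h →
      orientₚ c d e f g h :* b :+ orientₚ e f a b g h :* d :+ orientₚ a b c d g h :* f
        := orientₚ a b c d e f :* h) refl
    (x q) (y q) (x r) (y r) (x s) (y s) (x p) (y p)

  record LeftOf (e f p : Point) : Set where
    constructor leftOf
    field side : 0# ≤ᵣ orient e f p

  record Positive (q r s : Point) : Set where
    constructor positive
    field turn : 0# < orient q r s

  positive-rotate : ∀ {q r s} → Positive q r s → Positive r s q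
  positive-rotate {q} {r} {s} (positive t) = positive (<-resp refl (orient-cyclic q r s) t)

  positive-left : ∀ {q r s} → Positive q r s → LeftOf q r s
  positive-left (positive t) = leftOf (inj₁ t)

  left-at-tail : ∀ e f → LeftOf e f e
  left-at-tail e f = leftOf (inj₂ (sym (orient-tail e f)))

  left-at-head : ∀ e f → LeftOf e f f
  left-at-head e f = leftOf (inj₂ (sym (orient-head e f)))

  side-of : ∀ e f p → LeftOf e f p ⊎ LeftOf f e p
  side-of e f p with sign (orient e f p)
  ... | inj₁ left  = inj₁ (leftOf left)
  ... | inj₂ right = inj₂ (leftOf (≤-resp refl (orient-swap e f p) right))

  record Inside (q r s p : Point) : Set where
    constructor inside
    field
      left-qr : LeftOf q r p
      left-rs : LeftOf r s p
      left-sq : LeftOf s q p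

  corners : Point → Point → Point → Fin 3 → Point
  corners q r s fz           = q
  corners q r s (fs fz)      = r
  corners q r s (fs (fs fz)) = s

  InTriangle : Point → Point → Point → Point → Set
  InTriangle q r s p = InHull 3 (corners q r s) (λ _ → ⊤) p

  -- orient e f is affine in its last argument: in homogeneous coordinates
  -- (X , Y , S) it is the following linear form
  edgeForm : Point → Point → Carrier → Carrier → Carrier → Carrier
  edgeForm e f X Y S = (x f - x e) * Y - (y f - y e) * X + ((y f - y e) * x e - (x f - x e) * y e) * S

  edgeFormₚ : ∀ {n} (a b c d X Y S : Polynomial n) → Polynomial n
  edgeFormₚ a b c d X Y S = (c :- a) :* Y :- (d :- b) :* X :+ ((d :- b) :* a :- (c :- a) :* b) :* S

  form-cong : ∀ e f {X X′ Y Y′ S S′} → X ≈ X′ → Y ≈ Y′ → S ≈ S′ →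
    edgeForm e f X Y S ≈ edgeForm e f X′ Y′ S′
  form-cong e f X≈ Y≈ S≈ = +-cong (+-cong (*-congˡ Y≈) (-‿cong (*-congˡ X≈))) (*-congˡ S≈)

  orient-form : ∀ e f z → orient e f z ≈ edgeForm e f (x z) (y z) 1#
  orient-form e f z = trans
    (solve 6 (λ a b c d g h → orientₚ a b c d g h := edgeFormₚ a b c d g h (con (1 , 0))) refl
      (x e) (y e) (x f) (y f) (x z) (y z))
    (form-cong e f refl refl embed-1)

  form-zero : ∀ e f → edgeForm e f 0# 0# 0# ≈ 0#
  form-zero e f = trans (form-cong e f (sym embed-0) (sym embed-0) (sym embed-0)) (trans
    (solve 4 (λ a b c d → edgeFormₚ a b c d (con (0 , 0)) (con (0 , 0)) (con (0 , 0)) := con (0 , 0)) refl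
      (x e) (y e) (x f) (y f))
    embed-0)

  form-step : ∀ e f w X Y X′ Y′ S′ →
    w * edgeForm e f X Y 1# + edgeForm e f X′ Y′ S′ ≈ edgeForm e f (w * X + X′) (w * Y + Y′) (w + S′)
  form-step e f w X Y X′ Y′ S′ = trans
    (solve 11 (λ a b c d w X Y X′ Y′ S′ one →
        w :* edgeFormₚ a b c d X Y one :+ edgeFormₚ a b c d X′ Y′ S′
          := edgeFormₚ a b c d (w :* X :+ X′) (w :* Y :+ Y′) (w :* one :+ S′)) refl
      (x e) (y e) (x f) (y f) w X Y X′ Y′ S′ 1#)
    (form-cong e f refl refl (+-congʳ (*-identityʳ w)))

  weighted-orient : ∀ e f n (w : Fin n → Carrier) (v : Fin n → Point) →
    Σᶠ n (λ k → w k * orient e f (v k))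
      ≈ edgeForm e f (Σᶠ n (λ k → w k * x (v k))) (Σᶠ n (λ k → w k * y (v k))) (Σᶠ n w)
  weighted-orient e f zero    w v = sym (form-zero e f)
  weighted-orient e f (suc n) w v =
    trans (+-cong (*-congˡ (orient-form e f (v fz))) (weighted-orient e f n (λ k → w (fs k)) (λ k → v (fs k))))
          (form-step e f (w fz) _ _ _ _ _)

  hull-left : ∀ {n v S p e f} → InHull n v S p → (∀ k → LeftOf e f (v k)) → LeftOf e f p
  hull-left {n} {v} {S} {p} {e} {f} (w , w≥0 , _ , Σw≈1 , Σwx≈x , Σwy≈y) left =
    leftOf (≤-resp refl combination (Σ-nonneg n _ (λ k → *-nonneg (w≥0 k) (LeftOf.side (left k)))))
    where
    combination : Σᶠ n (λ k → w k * orient e f (v k)) ≈ orient e f p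
    combination = begin
      Σᶠ n (λ k → w k * orient e f (v k))  ≈⟨ weighted-orient e f n w v ⟩
      edgeForm e f _ _ (Σᶠ n w)            ≈⟨ form-cong e f Σwx≈x Σwy≈y Σw≈1 ⟩
      edgeForm e f (x p) (y p) 1#          ≈⟨ orient-form e f p ⟨
      orient e f p                         ∎

  triangle-left : ∀ {q r s p e f} → InTriangle q r s p →
    LeftOf e f q → LeftOf e f r → LeftOf e f s → LeftOf e f p
  triangle-left {q} {r} {s} {e = e} {f} t left-q left-r left-s = hull-left t at-corner
    where
    at-corner : ∀ k → LeftOf e f (corners q r s k)
    at-corner fz           = left-q
    at-corner (fs fz)      = left-r
    at-corner (fs (fs fz)) = left-s

  -- Cramer's rule: inside a positive triangle the normalised sub-triangle
  -- orientations are barycentric coordinates of p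
  barycentric : ∀ {q r s p} → Positive q r s → Inside q r s p → InTriangle q r s p
  barycentric {q} {r} {s} {p} (positive D>0) (inside l-qr l-rs l-sq)
    with inverse (orient q r s) (λ D≈0 → <-irrefl (<-resp refl D≈0 D>0))
  ... | d , Dd≈1 = weight , weight≥0 , (λ _ ¬⊤ → ⊥-elim (¬⊤ tt)) , total ,
      coordinate x (orient-sum-x q r s p) , coordinate y (orient-sum-y q r s p)
    where
    weight : Fin 3 → Carrier
    weight fz           = orient r s p * d
    weight (fs fz)      = orient s q p * d
    weight (fs (fs fz)) = orient q r p * d

    d≥0 : 0# ≤ᵣ d
    d≥0 = inj₁ (inverse-pos D>0 Dd≈1)

    weight≥0 : ∀ k → 0# ≤ᵣ weight k
    weight≥0 fz           = *-nonneg (LeftOf.side l-rs) d≥0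
    weight≥0 (fs fz)      = *-nonneg (LeftOf.side l-sq) d≥0
    weight≥0 (fs (fs fz)) = *-nonneg (LeftOf.side l-qr) d≥0

    Σ-three : ∀ h → Σᶠ 3 h ≈ h fz + h (fs fz) + h (fs (fs fz))
    Σ-three h = trans (+-congˡ (+-congˡ (+-identityʳ _))) (sym (+-assoc _ _ _))

    total : Σᶠ 3 weight ≈ 1#
    total = begin
      Σᶠ 3 weight                                               ≈⟨ Σ-three weight ⟩
      orient r s p * d + orient s q p * d + orient q r p * d    ≈⟨ sum-scale _ _ _ d ⟩
      (orient r s p + orient s q p + orient q r p) * d          ≈⟨ *-congʳ (orient-sum q r s p) ⟩
      orient q r s * d                                          ≈⟨ Dd≈1 ⟩
      1#                                                        ∎
      where
      sum-scale : ∀ a b c d → a * d + b * d + c * d ≈ (a + b + c) * d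
      sum-scale = solve 4 (λ a b c d → a :* d :+ b :* d :+ c :* d := (a :+ b :+ c) :* d) refl

    coordinate : (c : Point → Carrier) →
      orient r s p * c q + orient s q p * c r + orient q r p * c s ≈ orient q r s * c p →
      Σᶠ 3 (λ k → weight k * c (corners q r s k)) ≈ c p
    coordinate c cramer = begin
      Σᶠ 3 (λ k → weight k * c (corners q r s k))                  ≈⟨ Σ-three (λ k → weight k * c (corners q r s k)) ⟩
      (a * d) * c q + (b * d) * c r + (e * d) * c s                ≈⟨ combine a b e d (c q) (c r) (c s) ⟩
      (a * c q + b * c r + e * c s) * d                            ≈⟨ *-congʳ cramer ⟩
      (orient q r s * c p) * d                                     ≈⟨ *-assoc _ (c p) d ⟩
      orient q r s * (c p * d)                                     ≈⟨ *-congˡ (*-comm (c p) d) ⟩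
      orient q r s * (d * c p)                                     ≈⟨ *-assoc _ d (c p) ⟨
      (orient q r s * d) * c p                                     ≈⟨ *-congʳ Dd≈1 ⟩
      1# * c p                                                     ≈⟨ *-identityˡ (c p) ⟩
      c p                                                          ∎
      where
      a b e : Carrier
      a = orient r s p
      b = orient s q p
      e = orient q r p
      combine : ∀ a b e d X Y Z → (a * d) * X + (b * d) * Y + (e * d) * Z ≈ (a * X + b * Y + e * Z) * d
      combine = solve 7 (λ a b e d X Y Z →
        (a :* d) :* X :+ (b :* d) :* Y :+ (e :* d) :* Z := (a :* X :+ b :* Y :+ e :* Z) :* d) refl

  record ConvexQuad (q₀ q₁ q₂ q₃ : Point) : Set where
    field
      turn₀₁₂ : Positive q₀ q₁ q₂
      turn₀₁₃ : Positive q₀ q₁ q₃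
      turn₀₂₃ : Positive q₀ q₂ q₃
      turn₁₂₃ : Positive q₁ q₂ q₃

  -- The diagonal q₁q₃ cuts a convex quadrilateral into two triangles, so the
  -- triangle q₀q₁q₂ is covered by q₀q₁q₃ ∪ q₁q₂q₃.
  quad-split : ∀ {q₀ q₁ q₂ q₃ p} → ConvexQuad q₀ q₁ q₂ q₃ → Inside q₀ q₁ q₂ p →
    Inside q₀ q₁ q₃ p ⊎ Inside q₁ q₂ q₃ p
  quad-split {q₀} {q₁} {q₂} {q₃} {p} quad ins@(inside left₀₁ left₁₂ _) = by-side (side-of q₁ q₃ p)
    where
    open ConvexQuad quad
    tri : InTriangle q₀ q₁ q₂ p
    tri = barycentric turn₀₁₂ ins

    by-side : LeftOf q₁ q₃ p ⊎ LeftOf q₃ q₁ p → Inside q₀ q₁ q₃ p ⊎ Inside q₁ q₂ q₃ p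
    by-side (inj₁ left₁₃) = inj₁ (inside left₀₁ left₁₃ (triangle-left tri
      (left-at-head q₃ q₀)
      (positive-left (positive-rotate (positive-rotate turn₀₁₃)))
      (positive-left (positive-rotate (positive-rotate turn₀₂₃)))))
    by-side (inj₂ left₃₁) = inj₂ (inside left₁₂ (triangle-left tri
      (positive-left (positive-rotate turn₀₂₃))
      (positive-left (positive-rotate turn₁₂₃))
      (left-at-tail q₂ q₃)) left₃₁)

  reflect : Point → Point
  reflect q = ⟨ y q , x q ⟩

  orient-reflect : ∀ q r s → orient (reflect q) (reflect r) (reflect s) ≈ - orient q r s
  orient-reflect q r s = solve 6 (λ a b c d e f → orientₚ b a d c f e := :- orientₚ a b c d e f) refl
    (x q) (y q) (x r) (y r) (x s) (y s)

  reflect-hull : ∀ {n v S p} → InHull n v S p → InHull n (λ k → reflect (v k)) S (reflect p)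
  reflect-hull (w , w≥0 , outside , Σw≈1 , Σwx , Σwy) = w , w≥0 , outside , Σw≈1 , Σwy , Σwx

  unreflect-hull : ∀ {n v S p} → InHull n (λ k → reflect (v k)) S (reflect p) → InHull n v S p
  unreflect-hull (w , w≥0 , outside , Σw≈1 , Σwx , Σwy) = w , w≥0 , outside , Σw≈1 , Σwy , Σwx

module CyclicIndices where
  open import Data.Nat.DivMod using (_%_; _mod_; m<n⇒m%n≡m; [m+n]%n≡m%n)
  open P using (trans; sym; cong; subst; subst₂)

  -- a, b, c are met in this order when going around 0, 1, …, n−1, 0, …
  Cyclic : ℕ → ℕ → ℕ → Set
  Cyclic a b c = (a <ℕ b × b <ℕ c) ⊎ ((b <ℕ c × c <ℕ a) ⊎ (c <ℕ a × a <ℕ b))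

  module Rotation (n : ℕ) .{{_ : NonZero n}} where

    rot : Fin n → ℕ → Fin n
    rot s t = (toℕ s ℕ.+ t) mod n

    toℕ-rot : ∀ s t → toℕ (rot s t) ≡ (toℕ s ℕ.+ t) % n
    toℕ-rot s t = FinP.toℕ-fromℕ< _

    data Landing (s : Fin n) (t : ℕ) : Set where
      direct  : toℕ s ℕ.+ t <ℕ n → toℕ (rot s t) ≡ toℕ s ℕ.+ t → Landing s t
      wrapped : n ≤ℕ toℕ s ℕ.+ t → toℕ (rot s t) ℕ.+ n ≡ toℕ s ℕ.+ t → Landing s t

    landing : ∀ s t → t <ℕ n → Landing s t
    landing s t t<n with toℕ s ℕ.+ t ℕ.<? n
    ... | yes st<n = direct st<n (trans (toℕ-rot s t) (m<n⇒m%n≡m st<n))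
    ... | no  st≮n = wrapped n≤st (begin
      toℕ (rot s t) ℕ.+ n        ≡⟨ cong (ℕ._+ n) (toℕ-rot s t) ⟩
      (toℕ s ℕ.+ t) % n ℕ.+ n    ≡⟨ cong (λ m → m % n ℕ.+ n) (sym (ℕP.m∸n+n≡m n≤st)) ⟩
      (r ℕ.+ n) % n ℕ.+ n        ≡⟨ cong (ℕ._+ n) ([m+n]%n≡m%n r n) ⟩
      r % n ℕ.+ n                ≡⟨ cong (ℕ._+ n) (m<n⇒m%n≡m r<n) ⟩
      r ℕ.+ n                    ≡⟨ ℕP.m∸n+n≡m n≤st ⟩
      toℕ s ℕ.+ t                ∎)
      where
      open P.≡-Reasoning
      n≤st : n ≤ℕ toℕ s ℕ.+ t
      n≤st = ℕP.≮⇒≥ st≮n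
      r : ℕ
      r = toℕ s ℕ.+ t ℕ.∸ n
      r<n : r <ℕ n
      r<n = ℕP.+-cancelʳ-< n r n (subst (_<ℕ n ℕ.+ n) (sym (ℕP.m∸n+n≡m n≤st))
              (ℕP.+-mono-< (FinP.toℕ<n s) t<n))

    direct-mono : ∀ (s : Fin n) {t t′ r r′} →
      r ≡ toℕ s ℕ.+ t → r′ ≡ toℕ s ℕ.+ t′ → t <ℕ t′ → r <ℕ r′
    direct-mono s P.refl P.refl t<t′ = ℕP.+-monoʳ-< (toℕ s) t<t′

    wrapped-mono : ∀ (s : Fin n) {t t′ r r′} →
      r ℕ.+ n ≡ toℕ s ℕ.+ t → r′ ℕ.+ n ≡ toℕ s ℕ.+ t′ → t <ℕ t′ → r <ℕ r′
    wrapped-mono s {r = r} {r′} e e′ t<t′ =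
      ℕP.+-cancelʳ-< n r r′ (subst₂ _<ℕ_ (sym e) (sym e′) (ℕP.+-monoʳ-< (toℕ s) t<t′))

    wrapped-before-direct : ∀ (s : Fin n) {t t′ r r′} →
      r ℕ.+ n ≡ toℕ s ℕ.+ t → t <ℕ n → r′ ≡ toℕ s ℕ.+ t′ → r <ℕ r′
    wrapped-before-direct s {t′ = t′} {r} e t<n P.refl = ℕP.<-≤-trans r<s (ℕP.m≤m+n (toℕ s) t′)
      where
      r<s : r <ℕ toℕ s
      r<s = ℕP.+-cancelˡ-< n r (toℕ s) (subst₂ _<ℕ_ (ℕP.+-comm r n) (ℕP.+-comm (toℕ s) n)
              (subst (_<ℕ toℕ s ℕ.+ n) (sym e) (ℕP.+-monoʳ-< (toℕ s) t<n)))

    no-unwrap : ∀ (s : Fin n) {t t′} → t <ℕ t′ → n ≤ℕ toℕ s ℕ.+ t → toℕ s ℕ.+ t′ <ℕ n → ⊥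
    no-unwrap s t<t′ n≤st st′<n = ℕP.<-irrefl P.refl
      (ℕP.<-trans (ℕP.≤-<-trans n≤st (ℕP.+-monoʳ-< (toℕ s) t<t′)) st′<n)

    rot-cyclic : ∀ s {a b c} → a <ℕ b → b <ℕ c → c <ℕ n →
      Cyclic (toℕ (rot s a)) (toℕ (rot s b)) (toℕ (rot s c))
    rot-cyclic s {a} {b} {c} a<b b<c c<n
      with landing s a (ℕP.<-trans a<b (ℕP.<-trans b<c c<n)) | landing s b (ℕP.<-trans b<c c<n) | landing s c c<n
    ... | direct _ ra | direct _ rb | direct _ rc =
      inj₁ (direct-mono s {a} {b} ra rb a<b , direct-mono s {b} {c} rb rc b<c)
    ... | direct _ ra | direct _ rb | wrapped _ rc =
      inj₂ (inj₂ (wrapped-before-direct s {c} {a} rc c<n ra , direct-mono s {a} {b} ra rb a<b))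
    ... | direct _ ra | wrapped _ rb | wrapped _ rc =
      inj₂ (inj₁ (wrapped-mono s {b} {c} rb rc b<c , wrapped-before-direct s {c} {a} rc c<n ra))
    ... | wrapped _ ra | wrapped _ rb | wrapped _ rc =
      inj₁ (wrapped-mono s {a} {b} ra rb a<b , wrapped-mono s {b} {c} rb rc b<c)
    ... | wrapped n≤sa _ | direct sb<n _ | _ = ⊥-elim (no-unwrap s {a} {b} a<b n≤sa sb<n)
    ... | _ | wrapped n≤sb _ | direct sc<n _ = ⊥-elim (no-unwrap s {b} {c} b<c n≤sb sc<n)

    rot-zero : ∀ s → rot s 0 ≡ s
    rot-zero s = FinP.toℕ-injective (trans (toℕ-rot s 0)
      (trans (cong (_% n) (ℕP.+-identityʳ (toℕ s))) (m<n⇒m%n≡m (FinP.toℕ<n s))))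

    rot-forward : ∀ s (k : Fin n) → toℕ s ≤ℕ toℕ k → rot s (toℕ k ℕ.∸ toℕ s) ≡ k
    rot-forward s k s≤k = FinP.toℕ-injective (begin
      toℕ (rot s (toℕ k ℕ.∸ toℕ s))        ≡⟨ toℕ-rot s _ ⟩
      (toℕ s ℕ.+ (toℕ k ℕ.∸ toℕ s)) % n    ≡⟨ cong (_% n) (ℕP.m+[n∸m]≡n s≤k) ⟩
      toℕ k % n                            ≡⟨ m<n⇒m%n≡m (FinP.toℕ<n k) ⟩
      toℕ k                                ∎)
      where open P.≡-Reasoning

    rot-backward : ∀ s (k : Fin n) → toℕ k <ℕ toℕ s → rot s (n ℕ.∸ toℕ s ℕ.+ toℕ k) ≡ k
    rot-backward s k k<s = FinP.toℕ-injective (begin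
      toℕ (rot s (n ℕ.∸ toℕ s ℕ.+ toℕ k))             ≡⟨ toℕ-rot s _ ⟩
      (toℕ s ℕ.+ (n ℕ.∸ toℕ s ℕ.+ toℕ k)) % n         ≡⟨ cong (_% n) (sym (ℕP.+-assoc (toℕ s) _ (toℕ k))) ⟩
      (toℕ s ℕ.+ (n ℕ.∸ toℕ s) ℕ.+ toℕ k) % n         ≡⟨ cong (λ m → (m ℕ.+ toℕ k) % n) s+[n∸s]≡n ⟩
      (n ℕ.+ toℕ k) % n                               ≡⟨ cong (_% n) (ℕP.+-comm n (toℕ k)) ⟩
      (toℕ k ℕ.+ n) % n                               ≡⟨ [m+n]%n≡m%n (toℕ k) n ⟩
      toℕ k % n                                       ≡⟨ m<n⇒m%n≡m (FinP.toℕ<n k) ⟩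
      toℕ k                                           ∎)
      where
      open P.≡-Reasoning
      s+[n∸s]≡n : toℕ s ℕ.+ (n ℕ.∸ toℕ s) ≡ n
      s+[n∸s]≡n = ℕP.m+[n∸m]≡n (ℕP.<⇒≤ (FinP.toℕ<n s))

    dist : Fin n → Fin n → ℕ
    dist s k with toℕ s ℕ.≤? toℕ k
    ... | yes _ = toℕ k ℕ.∸ toℕ s
    ... | no  _ = n ℕ.∸ toℕ s ℕ.+ toℕ k

    data DistCase (s k : Fin n) (d : ℕ) : Set where
      ahead  : toℕ s ≤ℕ toℕ k → d ≡ toℕ k ℕ.∸ toℕ s → DistCase s k d
      behind : toℕ k <ℕ toℕ s → d ≡ n ℕ.∸ toℕ s ℕ.+ toℕ k → DistCase s k d

    dist-case : ∀ s k → DistCase s k (dist s k)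
    dist-case s k with toℕ s ℕ.≤? toℕ k
    ... | yes s≤k = ahead s≤k P.refl
    ... | no  s≰k = behind (ℕP.≰⇒> s≰k) P.refl

    rot-dist : ∀ s k → rot s (dist s k) ≡ k
    rot-dist s k with dist-case s k
    ... | ahead  s≤k e = trans (cong (rot s) e) (rot-forward s k s≤k)
    ... | behind k<s e = trans (cong (rot s) e) (rot-backward s k k<s)

    dist<n : ∀ s k → dist s k <ℕ n
    dist<n s k with dist-case s k
    ... | ahead  _   e = subst (_<ℕ n) (sym e) (ℕP.≤-<-trans (ℕP.m∸n≤m (toℕ k) (toℕ s)) (FinP.toℕ<n k))
    ... | behind k<s e = subst (_<ℕ n) (sym e) (subst (n ℕ.∸ toℕ s ℕ.+ toℕ k <ℕ_)
      (ℕP.m∸n+n≡m (ℕP.<⇒≤ (FinP.toℕ<n s))) (ℕP.+-monoʳ-< (n ℕ.∸ toℕ s) k<s))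

    dist-cyclic : ∀ s a b → Cyclic (toℕ s) (toℕ a) (toℕ b) → 0 <ℕ dist s a × dist s a <ℕ dist s b
    dist-cyclic s a b cyc with dist-case s a | dist-case s b | cyc
    ... | ahead _ ea | ahead _ eb | inj₁ (s<a , a<b) =
      subst (0 <ℕ_) (sym ea) (ℕP.m<n⇒0<n∸m s<a) ,
      subst₂ _<ℕ_ (sym ea) (sym eb) (ℕP.∸-monoˡ-< a<b (ℕP.<⇒≤ s<a))
    ... | behind _ ea | behind _ eb | inj₂ (inj₁ (a<b , b<s)) =
      subst (0 <ℕ_) (sym ea) (ℕP.<-≤-trans (ℕP.m<n⇒0<n∸m (FinP.toℕ<n s)) (ℕP.m≤m+n _ (toℕ a))) ,
      subst₂ _<ℕ_ (sym ea) (sym eb) (ℕP.+-monoʳ-< (n ℕ.∸ toℕ s) a<b)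
    ... | ahead _ ea | behind _ eb | inj₂ (inj₂ (b<s , s<a)) =
      subst (0 <ℕ_) (sym ea) (ℕP.m<n⇒0<n∸m s<a) ,
      subst₂ _<ℕ_ (sym ea) (sym eb) (ℕP.<-≤-trans (ℕP.∸-monoˡ-< (FinP.toℕ<n a) (ℕP.<⇒≤ s<a)) (ℕP.m≤m+n _ (toℕ b)))
    ... | ahead s≤a _ | _ | inj₂ (inj₁ (a<b , b<s)) = ⊥-elim (ℕP.<-irrefl P.refl (ℕP.≤-<-trans s≤a (ℕP.<-trans a<b b<s)))
    ... | behind a<s _ | _ | inj₁ (s<a , _) = ⊥-elim (ℕP.<-irrefl P.refl (ℕP.<-trans a<s s<a))
    ... | behind a<s _ | _ | inj₂ (inj₂ (_ , s<a)) = ⊥-elim (ℕP.<-irrefl P.refl (ℕP.<-trans a<s s<a))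
    ... | ahead _ _ | behind b<s _ | inj₁ (s<a , a<b) = ⊥-elim (ℕP.<-irrefl P.refl (ℕP.<-trans b<s (ℕP.<-trans s<a a<b)))
    ... | _ | ahead s≤b _ | inj₂ (inj₂ (b<s , _)) = ⊥-elim (ℕP.<-irrefl P.refl (ℕP.≤-<-trans s≤b b<s))
    ... | _ | ahead s≤b _ | inj₂ (inj₁ (_ , b<s)) = ⊥-elim (ℕP.<-irrefl P.refl (ℕP.≤-<-trans s≤b b<s))

module Labels where
  open P using (refl; sym; trans)

  TwoAlike : Part → Part → Part → Set
  TwoAlike l₁ l₂ l₃ = l₁ ≡ l₂ ⊎ (l₂ ≡ l₃ ⊎ l₁ ≡ l₃)

  _≟ₚ_ : (x y : Part) → Dec (x ≡ y)
  A ≟ₚ A = yes refl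
  A ≟ₚ B = no (λ ())
  A ≟ₚ C = no (λ ())
  B ≟ₚ A = no (λ ())
  B ≟ₚ B = yes refl
  B ≟ₚ C = no (λ ())
  C ≟ₚ A = no (λ ())
  C ≟ₚ B = no (λ ())
  C ≟ₚ C = yes refl

  remaining : ∀ x u → ¬ u ≡ x → Σ Part (λ z → ∀ y → ¬ y ≡ x → ¬ y ≡ u → y ≡ z)
  remaining A A u≢x = ⊥-elim (u≢x refl)
  remaining B B u≢x = ⊥-elim (u≢x refl)
  remaining C C u≢x = ⊥-elim (u≢x refl)
  remaining A B _ = C , λ { A y≢x _ → ⊥-elim (y≢x refl) ; B _ y≢u → ⊥-elim (y≢u refl) ; C _ _ → refl }
  remaining B A _ = C , λ { B y≢x _ → ⊥-elim (y≢x refl) ; A _ y≢u → ⊥-elim (y≢u refl) ; C _ _ → refl }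
  remaining A C _ = B , λ { A y≢x _ → ⊥-elim (y≢x refl) ; C _ y≢u → ⊥-elim (y≢u refl) ; B _ _ → refl }
  remaining C A _ = B , λ { C y≢x _ → ⊥-elim (y≢x refl) ; A _ y≢u → ⊥-elim (y≢u refl) ; B _ _ → refl }
  remaining B C _ = A , λ { B y≢x _ → ⊥-elim (y≢x refl) ; C _ y≢u → ⊥-elim (y≢u refl) ; A _ _ → refl }
  remaining C B _ = A , λ { C y≢x _ → ⊥-elim (y≢x refl) ; B _ y≢u → ⊥-elim (y≢u refl) ; A _ _ → refl }

  same-remaining : ∀ {x u y w} → ¬ u ≡ x → ¬ y ≡ x → ¬ y ≡ u → ¬ w ≡ x → ¬ w ≡ u → y ≡ w
  same-remaining {x} {u} {y} {w} u≢x y≢x y≢u w≢x w≢u with remaining x u u≢x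
  ... | z , only-z = trans (only-z y y≢x y≢u) (sym (only-z w w≢x w≢u))

  avoid : ∀ x y → Σ Part (λ z → ¬ x ≡ z × ¬ y ≡ z)
  avoid A A = B , (λ ()) , (λ ())
  avoid A B = C , (λ ()) , (λ ())
  avoid A C = B , (λ ()) , (λ ())
  avoid B A = C , (λ ()) , (λ ())
  avoid B B = A , (λ ()) , (λ ())
  avoid B C = A , (λ ()) , (λ ())
  avoid C A = B , (λ ()) , (λ ())
  avoid C B = A , (λ ()) , (λ ())
  avoid C C = A , (λ ()) , (λ ())

  missing : ∀ {l₁ l₂ l₃} → TwoAlike l₁ l₂ l₃ → Σ Part (λ z → ¬ l₁ ≡ z × ¬ l₂ ≡ z × ¬ l₃ ≡ z)
  missing {l₁} {l₂} {l₃} (inj₁ refl) with avoid l₁ l₃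
  ... | z , l₁≢z , l₃≢z = z , l₁≢z , l₁≢z , l₃≢z
  missing {l₁} {l₂} {l₃} (inj₂ (inj₁ refl)) with avoid l₁ l₂
  ... | z , l₁≢z , l₂≢z = z , l₁≢z , l₂≢z , l₂≢z
  missing {l₁} {l₂} {l₃} (inj₂ (inj₂ refl)) with avoid l₁ l₂
  ... | z , l₁≢z , l₂≢z = z , l₁≢z , l₂≢z , l₁≢z

  OtherTwo : Part → Part → Set
  OtherTwo A l = l ≡ B ⊎ l ≡ C
  OtherTwo B l = l ≡ A ⊎ l ≡ C
  OtherTwo C l = l ≡ A ⊎ l ≡ B

  other-two : ∀ z l → ¬ l ≡ z → OtherTwo z l
  other-two A A l≢z = ⊥-elim (l≢z refl)
  other-two A B _   = inj₁ refl
  other-two A C _   = inj₂ refl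
  other-two B A _   = inj₁ refl
  other-two B B l≢z = ⊥-elim (l≢z refl)
  other-two B C _   = inj₂ refl
  other-two C A _   = inj₁ refl
  other-two C B _   = inj₂ refl
  other-two C C l≢z = ⊥-elim (l≢z refl)

module Chains (ℝ : RealField) where
  open Geometry ℝ
  open PlaneGeometry ℝ
  open Labels
  open P using (refl; sym; trans; cong; subst)

  ConvexChain : ℕ → (ℕ → Point) → Set
  ConvexChain N q = ∀ {a b c} → a <ℕ b → b <ℕ c → c <ℕ N → Positive (q a) (q b) (q c)

  chain-quad : ∀ {N q a b c d} → ConvexChain N q → a <ℕ b → b <ℕ c → c <ℕ d → d <ℕ N →
    ConvexQuad (q a) (q b) (q c) (q d)
  chain-quad convex a<b b<c c<d d<N = record
    { turn₀₁₂ = convex a<b b<c (ℕP.<-trans c<d d<N)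
    ; turn₀₁₃ = convex a<b (ℕP.<-trans b<c c<d) d<N
    ; turn₀₂₃ = convex (ℕP.<-trans a<b b<c) c<d d<N
    ; turn₁₂₃ = convex b<c c<d d<N
    }

  chain-edge : ∀ {N q t r} → ConvexChain N q → suc t <ℕ N → r <ℕ N → LeftOf (q t) (q (suc t)) (q r)
  chain-edge {t = t} {r} convex st<N r<N with ℕP.<-cmp r t
  ... | tri< r<t _ _    = positive-left (positive-rotate (convex r<t (ℕP.n<1+n t) st<N))
  ... | tri≈ _ refl _   = left-at-tail _ _
  ... | tri> _ _ t<r with ℕP.<-cmp r (suc t)
  ...   | tri< r<st _ _  = ⊥-elim (ℕP.<-irrefl refl (ℕP.<-≤-trans t<r (ℕP.≤-pred r<st)))
  ...   | tri≈ _ refl _  = left-at-head _ _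
  ...   | tri> _ _ st<r  = positive-left (convex (ℕP.n<1+n t) st<r r<N)

  record FanTriangle (q : ℕ → Point) (m : ℕ) (p : Point) : Set where
    constructor fanTriangle
    field
      t          : ℕ
      0<t        : 0 <ℕ t
      t<m        : t <ℕ m
      inside-fan : Inside (q 0) (q t) (q (suc t)) p

  -- The fan from q 0 covers the polygon q 0 … q m.  If p lies left of all its
  -- edges, walk t = 1, 2, … while p stays left of q 0 → q t; at the first
  -- t where p is right of q 0 → q (t+1) (at the latest t + 1 = m) p is in
  -- the fan triangle at t.
  fan : ∀ {q m p} → 2 ≤ℕ m →
    (∀ t → t <ℕ m → LeftOf (q t) (q (suc t)) p) → LeftOf (q m) (q 0) p → FanTriangle q m p
  fan {q} {m} {p} 2≤m edge closing =
    walk (m ℕ.∸ 2) 1 start (s≤s z≤n) (edge 0 (ℕP.<-≤-trans (s≤s z≤n) 2≤m))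
    where
    start : suc (m ℕ.∸ 2 ℕ.+ 1) ≡ m
    start = trans (sym (ℕP.+-suc (m ℕ.∸ 2) 1)) (ℕP.m∸n+n≡m 2≤m)

    before : ∀ r t → suc (r ℕ.+ t) ≡ m → t <ℕ m
    before r t e = subst (t <ℕ_) e (s≤s (ℕP.m≤n+m t r))

    -- r more steps remain after t
    walk : ∀ r t → suc (r ℕ.+ t) ≡ m → 0 <ℕ t → LeftOf (q 0) (q t) p → FanTriangle q m p
    walk zero t last 0<t left = fanTriangle t 0<t (before 0 t last)
      (inside left (edge t (before 0 t last)) (subst (λ i → LeftOf (q i) (q 0) p) (sym last) closing))
    walk (suc r) t e 0<t left with side-of (q 0) (q (suc t)) p
    ... | inj₁ left′ = walk r (suc t) (trans (cong suc (ℕP.+-suc r t)) e) (s≤s z≤n) left′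
    ... | inj₂ right = fanTriangle t 0<t (before (suc r) t e) (inside left (edge t (before (suc r) t e)) right)

  record TwoPartTriangle {I : Set} (q : I → Point) (lab : I → Part) (p : Point) : Set where
    constructor twoPartTriangle
    field
      a b c       : I
      in-triangle : InTriangle (q a) (q b) (q c) p
      two-alike   : TwoAlike (lab a) (lab b) (lab c)

  reindex : ∀ {I J : Set} {v : J → Point} {lab : J → Part} {p} (f : I → J) →
    TwoPartTriangle (λ i → v (f i)) (λ i → lab (f i)) p → TwoPartTriangle v lab p
  reindex f (twoPartTriangle a b c t alike) = twoPartTriangle (f a) (f b) (f c) t alike

  -- If the fan triangle q 0 , q t , q (t+1) of p
  -- is rainbow, then q k shares the label of q t or of q (t+1), and p lies in
  -- one of the triangles obtained by splitting along diagonals to q m and q k.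
  chain-core : ∀ {N q p X m k} (lab : ℕ → Part) → ConvexChain N q →
    2 ≤ℕ m → m <ℕ k → k <ℕ N → lab 0 ≡ X → lab m ≡ X → ¬ lab k ≡ X →
    (∀ t → t <ℕ m → LeftOf (q t) (q (suc t)) p) → LeftOf (q m) (q 0) p →
    TwoPartTriangle q lab p
  chain-core {N} {q} {p} {X} {m} {k} lab convex 2≤m m<k k<N lab₀ labₘ labₖ edge closing
    with fan 2≤m edge closing
  ... | fanTriangle t 0<t t<m ins =
    by-labels (lab t ≟ₚ X) (lab (suc t) ≟ₚ X) (lab t ≟ₚ lab (suc t))
    where
    m<N : m <ℕ N
    m<N = ℕP.<-trans m<k k<N
    t<st : t <ℕ suc t
    t<st = ℕP.n<1+n t
    st≤m : suc t ≤ℕ m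
    st≤m = t<m
    st<N : suc t <ℕ N
    st<N = ℕP.≤-<-trans st≤m m<N

    triangle : ∀ {a b c} → a <ℕ b → b <ℕ c → c <ℕ N → Inside (q a) (q b) (q c) p →
      TwoAlike (lab a) (lab b) (lab c) → TwoPartTriangle q lab p
    triangle a<b b<c c<N inside-abc alike =
      twoPartTriangle _ _ _ (barycentric (convex a<b b<c c<N) inside-abc) alike

    -- q k has the label of q t: split along the diagonal q t → q k
    beyond-like-t : lab k ≡ lab t → suc t <ℕ k → TwoPartTriangle q lab p
    beyond-like-t k~t st<k with quad-split (chain-quad convex 0<t t<st st<k k<N) ins
    ... | inj₁ in-0-t-k  = triangle 0<t (ℕP.<-trans t<st st<k) k<N in-0-t-k (inj₂ (inj₁ (sym k~t)))
    ... | inj₂ in-t-st-k  = triangle t<st st<k k<N in-t-st-k (inj₂ (inj₂ (sym k~t)))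

    -- q k has the label of q (t+1): split along q t → q m, then q (t+1) → q k
    beyond-like-st : lab k ≡ lab (suc t) → suc t <ℕ m → TwoPartTriangle q lab p
    beyond-like-st k~st st<m with quad-split (chain-quad convex 0<t t<st st<m m<N) ins
    ... | inj₁ in-0-t-m = triangle 0<t (ℕP.<-trans t<st st<m) m<N in-0-t-m (inj₂ (inj₂ (trans lab₀ (sym labₘ))))
    ... | inj₂ in-t-st-m with quad-split (chain-quad convex t<st st<m m<k k<N) in-t-st-m
    ...   | inj₁ in-t-st-k = triangle t<st (ℕP.<-trans st<m m<k) k<N in-t-st-k (inj₂ (inj₁ (sym k~st)))
    ...   | inj₂ in-st-m-k = triangle st<m m<k k<N in-st-m-k (inj₂ (inj₂ (sym k~st)))

    -- the fan triangle repeats a label unless it is rainbow: then q t , q (t+1) , q k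
    -- carry the two parts other than X, so q k shares the label of q t or q (t+1)
    by-labels : Dec (lab t ≡ X) → Dec (lab (suc t) ≡ X) → Dec (lab t ≡ lab (suc t)) →
      TwoPartTriangle q lab p
    by-labels (yes t~X) _ _ = triangle 0<t t<st st<N ins (inj₁ (trans lab₀ (sym t~X)))
    by-labels (no _) (yes st~X) _ = triangle 0<t t<st st<N ins (inj₂ (inj₂ (trans lab₀ (sym st~X))))
    by-labels (no _) (no _) (yes t~st) = triangle 0<t t<st st<N ins (inj₂ (inj₁ t~st))
    by-labels (no t≁X) (no st≁X) (no t≁st) with lab k ≟ₚ lab t
    ... | yes k~t = beyond-like-t k~t (ℕP.≤-<-trans st≤m m<k)
    ... | no  k≁t = beyond-like-st (same-remaining t≁X labₖ k≁t st≁X (λ st~t → t≁st (sym st~t))) st<m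
      where
      st<m : suc t <ℕ m
      st<m = ℕP.≤∧≢⇒< st≤m (λ st≡m → st≁X (trans (cong lab st≡m) labₘ))

module Polygons (ℝ : RealField) where
  open RealField ℝ using (_<_; 0#; <-resp; refl)
  open Geometry ℝ
  open PlaneGeometry ℝ
  open FiniteSums ℝ using (hull-map)
  open OrderedField ℝ using (neg-pos)
  open Chains ℝ
  open CyclicIndices
  open Labels
  open P using (sym; trans; cong; subst; subst₂)

  CounterClockwise : (n : ℕ) → (Fin n → Point) → Set
  CounterClockwise n v =
    ∀ (i j k : Fin n) → toℕ i <ℕ toℕ j → toℕ j <ℕ toℕ k → 0# < orient (v i) (v j) (v k)

  reflect-clockwise : ∀ {n} {v : Fin n → Point} →
    (∀ (i j k : Fin n) → toℕ i <ℕ toℕ j → toℕ j <ℕ toℕ k → orient (v i) (v j) (v k) < 0#) →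
    CounterClockwise n (λ k → reflect (v k))
  reflect-clockwise {v = v} cw i j k i<j j<k =
    <-resp refl (RealField.sym ℝ (orient-reflect (v i) (v j) (v k))) (neg-pos (cw i j k i<j j<k))

  cyclic-positive : ∀ {n} {v : Fin n → Point} → CounterClockwise n v →
    ∀ {i j k} → Cyclic (toℕ i) (toℕ j) (toℕ k) → Positive (v i) (v j) (v k)
  cyclic-positive ccw {i} {j} {k} (inj₁ (i<j , j<k))        = positive (ccw i j k i<j j<k)
  cyclic-positive ccw {i} {j} {k} (inj₂ (inj₁ (j<k , k<i))) =
    positive-rotate (positive-rotate (positive (ccw j k i j<k k<i)))
  cyclic-positive ccw {i} {j} {k} (inj₂ (inj₂ (k<i , i<j))) = positive-rotate (positive (ccw k i j k<i i<j))

  triangle-hull : ∀ {n} {v : Fin n → Point} (S : Fin n → Set) {a b c p} → S a → S b → S c →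
    InTriangle (v a) (v b) (v c) p → InHull n v S p
  triangle-hull {v = v} S {a} {b} {c} Sa Sb Sc = hull-map corner corner-point corner-S
    where
    corner : Fin 3 → Fin _
    corner fz           = a
    corner (fs fz)      = b
    corner (fs (fs fz)) = c
    corner-point : ∀ k → corners (v a) (v b) (v c) k ≡ v (corner k)
    corner-point fz           = P.refl
    corner-point (fs fz)      = P.refl
    corner-point (fs (fs fz)) = P.refl
    corner-S : ∀ k → S (corner k)
    corner-S fz           = Sa
    corner-S (fs fz)      = Sb
    corner-S (fs (fs fz)) = Sc

  module _ {n} .{{_ : NonZero n}} {v : Fin n → Point} (ccw : CounterClockwise n v) where
    open Rotation n

    rotated-chain : ∀ s → ConvexChain n (λ t → v (rot s t))
    rotated-chain s a<b b<c c<n = cyclic-positive ccw (rot-cyclic s a<b b<c c<n)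

    rotated-edge : ∀ {S p} → InHull n v S p → ∀ s t → suc t <ℕ n →
      LeftOf (v (rot s t)) (v (rot s (suc t))) p
    rotated-edge hull s t st<n = hull-left hull (λ k →
      subst (λ j → LeftOf (v (rot s t)) (v (rot s (suc t))) (v j)) (rot-dist s k)
            (chain-edge (rotated-chain s) st<n (dist<n s k)))

    polygon-core : ∀ {S p lab X s w e y} → InHull n v S p →
      Cyclic (toℕ s) (toℕ w) (toℕ e) → Cyclic (toℕ s) (toℕ e) (toℕ y) →
      lab s ≡ X → lab e ≡ X → ¬ lab y ≡ X → LeftOf (v e) (v s) p → TwoPartTriangle v lab p
    polygon-core {p = p} {lab} {X} {s} {w} {e} {y} hull s-w-e s-e-y lab-s lab-e lab-y chord =
      reindex (rot s) (chain-core (λ t → lab (rot s t)) (rotated-chain s)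
        2≤m m<k (dist<n s y)
        (trans (cong lab (rot-zero s)) lab-s)
        (trans (cong lab (rot-dist s e)) lab-e)
        (λ lab~X → lab-y (trans (cong lab (sym (rot-dist s y))) lab~X))
        (λ t t<m → rotated-edge hull s t (ℕP.≤-<-trans t<m (dist<n s e)))
        (subst₂ (λ i j → LeftOf (v i) (v j) p) (sym (rot-dist s e)) (sym (rot-zero s)) chord))
      where
      -- e and y lie m = dist s e and k = dist s y steps after s
      2≤m : 2 ≤ℕ dist s e
      2≤m with dist-cyclic s w e s-w-e
      ... | 0<w , w<e = ℕP.<-≤-trans (s≤s 0<w) w<e
      m<k : dist s e <ℕ dist s y
      m<k = proj₂ (dist-cyclic s e y s-e-y)

    -- The theorem for a counterclockwise polygon.  The chord a₁a₂ between
    -- the separated X-vertices cuts the polygon in two; on either side the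
    -- vertex of the other side plays the role of y.
    separated-triangle : ∀ {S p lab X} → InHull n v S p → Separated n lab X → TwoPartTriangle v lab p
    separated-triangle {p = p} hull (i , j , i<j , lab-i , lab-j , (w , i<w , w<j , lab-w) , (y , y-out , lab-y))
      with side-of (v j) (v i) p
    ... | inj₁ inner = polygon-core hull (inj₁ (i<w , w<j)) (i-j-y y-out) lab-i lab-j lab-y inner
      where
      i-j-y : toℕ y <ℕ toℕ i ⊎ toℕ j <ℕ toℕ y → Cyclic (toℕ i) (toℕ j) (toℕ y)
      i-j-y (inj₁ y<i) = inj₂ (inj₂ (y<i , i<j))
      i-j-y (inj₂ j<y) = inj₁ (i<j , j<y)
    ... | inj₂ outer = polygon-core hull (j-y-i y-out) (inj₂ (inj₁ (i<w , w<j))) lab-j lab-i lab-w outer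
      where
      j-y-i : toℕ y <ℕ toℕ i ⊎ toℕ j <ℕ toℕ y → Cyclic (toℕ j) (toℕ y) (toℕ i)
      j-y-i (inj₁ y<i) = inj₂ (inj₁ (y<i , i<j))
      j-y-i (inj₂ j<y) = inj₂ (inj₂ (i<j , j<y))

  InPairHull : (n : ℕ) → (Fin n → Point) → (Fin n → Part) → Point → Set
  InPairHull n v lab p =
      InHull n v (λ k → lab k ≡ A ⊎ lab k ≡ B) p
    ⊎ (InHull n v (λ k → lab k ≡ A ⊎ lab k ≡ C) p
    ⊎ InHull n v (λ k → lab k ≡ B ⊎ lab k ≡ C) p)

  -- a triangle of vertices with at most two distinct labels misses some part
  -- z, so it lies in the hull of the vertices of the other two parts
  triangle-in-pair-hull : ∀ {n} {v : Fin n → Point} {lab p} → TwoPartTriangle v lab p → InPairHull n v lab p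
  triangle-in-pair-hull {n} {v} {lab} {p} (twoPartTriangle a b c t alike) with missing alike
  ... | z , a≁z , b≁z , c≁z =
    select z (triangle-hull (λ k → OtherTwo z (lab k)) (other-two z _ a≁z) (other-two z _ b≁z) (other-two z _ c≁z) t)
    where
    select : ∀ z → InHull n v (λ k → OtherTwo z (lab k)) p → InPairHull n v lab p
    select A in-BC = inj₂ (inj₂ in-BC)
    select B in-AC = inj₂ (inj₁ in-AC)
    select C in-AB = inj₁ in-AB

  unreflect-pair-hull : ∀ {n} {v : Fin n → Point} {lab p} →
    InPairHull n (λ k → reflect (v k)) lab (reflect p) → InPairHull n v lab p
  unreflect-pair-hull {v = v} = Sum.map back (Sum.map back back)
    where
    back : ∀ {S p} → InHull _ (λ k → reflect (v k)) S (reflect p) → InHull _ v S p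
    back = unreflect-hull {v = v}

-- Theorem 7.  A clockwise polygon is first reflected to a counterclockwise
-- one; the bound 4 ≤ n is only needed to know that there are vertices.
mainTheorem7 : (ℝ : RealField) → let open Geometry ℝ in
    (n : ℕ) → 4 ≤ℕ n → (v : Fin n → Point) → ConvexPolygon n v →
    (lab : Fin n → Part) →
    Σ Part (Separated n lab) →
    (p : Point) → InHull n v (λ _ → ⊤) p →
      InHull n v (λ k → lab k ≡ A ⊎ lab k ≡ B) p
    ⊎ (InHull n v (λ k → lab k ≡ A ⊎ lab k ≡ C) p
    ⊎ InHull n v (λ k → lab k ≡ B ⊎ lab k ≡ C) p)
mainTheorem7 ℝ (suc _) (s≤s _) v (inj₁ ccw) lab (X , separated) p hull =
  triangle-in-pair-hull (separated-triangle ccw hull separated)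
  where open Polygons ℝ
mainTheorem7 ℝ (suc _) (s≤s _) v (inj₂ cw) lab (X , separated) p hull =
  unreflect-pair-hull {v = v} (triangle-in-pair-hull
    (separated-triangle (reflect-clockwise cw) (reflect-hull {v = v} hull) separated))
  where
  open Polygons ℝ
  open PlaneGeometry ℝ using (reflect-hull)
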